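{- Let $n \geq 3$ and let $S$ be a $4$-cap free, $n$-cup free configuration with $|S| \geq \binom{n-1}{2}+1$. Let $L(S)$ (resp. $R(S)$) be the set of starting points (resp. ending points) of all $(n-1)$-cups in $S$, let $p_S = \max L(S)$ and $q_S = \min R(S)$. Then $p_S \leq q_S$; that is, every point of $L(S)$ is $\le$ every point of $R(S)$.
   Context: A configuration is a finite set $S$ with a linear order $<$, together with an arbitrary assignment, to each $3$-element subset, of "cap" or "cup". Points $x_1 < \cdots < x_m$ form an $m$-cup (resp. $m$-cap) if every consecutive triple $x_{i-1}x_ix_{i+1}$ is labeled cup (resp. cap); 1- and 2-element sets count as both; it is a cup from its starting point $x_1$ to its ending point $x_m$. By the (set-theoretic) cups-caps theorem, a $4$-cap free, $n$-cup free configuration has at most $\binom{n-1}{2}$ points unless it contains an $(n-1)$-cup... more precisely, a $4$-cap free, $(n-1)$-cup free configuration has at most $\binom{n-2}{2}$ points, so under the hypothesis $S$ contains an $(n-1)$-cup and $L(S), R(S)$ are nonempty, making $p_S, q_S$ well-defined. -}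

module Defs where

open import Data.Nat using (ℕ)
open import Data.Fin using (Fin; _<_)
open import Data.Bool using (Bool; true; false)
open import Data.List using (List; []; _∷_; length)
open import Data.List.Relation.Unary.Linked using (Linked)
open import Data.Product using (_×_)
open import Data.Unit using (⊤)
open import Relation.Binary.PropositionalEquality using (_≡_)
open import Relation.Nullary using (¬_)

-- A configuration on N points: the underlying linearly ordered set is Fin N
-- with its natural order, and every triple i < j < k gets a label
-- (true = "cup", false = "cap").  Values on non-increasing triples are
-- never consulted.
Labeling : ℕ → Set
Labeling N = Fin N → Fin N → Fin N → Bool

ConsecLabel : ∀ {N} → Labeling N → Bool → List (Fin N) → Set
ConsecLabel lab b (x ∷ y ∷ z ∷ rest) = (lab x y z ≡ b) × ConsecLabel lab b (y ∷ z ∷ rest)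
ConsecLabel lab b _ = ⊤

IsCup : ∀ {N} → Labeling N → ℕ → List (Fin N) → Set
IsCup lab m xs = (length xs ≡ m) × Linked _<_ xs × ConsecLabel lab true xs

IsCap : ∀ {N} → Labeling N → ℕ → List (Fin N) → Set
IsCap lab m xs = (length xs ≡ m) × Linked _<_ xs × ConsecLabel lab false xs

CupFree : ∀ {N} → Labeling N → ℕ → Set
CupFree lab m = ∀ xs → ¬ IsCup lab m xs

CapFree : ∀ {N} → Labeling N → ℕ → Set
CapFree lab m = ∀ xs → ¬ IsCap lab m xs

{-# OPTIONS --safe #-}
module Submission where

-- If some (n-1)-cup ending at q lay entirely before some (n-1)-cup starting
-- at p, i.e. q < p, look at the last edge y q of the first cup and the first
-- edge p x of the second.  If y q p is a cup, p extends the first cup to an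
-- n-cup; if q p x is a cup, q extends the second one to an n-cup; otherwise
-- y q p x is a 4-cap.

open import Defs
open import Data.Nat using (ℕ; _+_; _∸_; _≤_; suc; s≤s)
open import Data.Nat.Combinatorics using (_C_)
open import Data.Nat.Properties using (+-suc; ≮⇒≥)
open import Data.Fin as F using (Fin)
open import Data.List using (List; []; _∷_; _∷ʳ_; _++_; length; initLast; _∷ʳ′_)
open import Data.List.Properties using (length-++; ++-assoc)
open import Data.List.Relation.Unary.Linked as Linked using (Linked; [-]; _∷_)
open import Data.Product using (_,_; proj₁)
open import Data.Unit using (tt)
open import Data.Bool using (true; false)
open import Level using (Level)
open import Relation.Binary.Core using (Rel)
open import Relation.Binary.PropositionalEquality using (_≡_; refl; sym; trans; cong; subst)
open import Relation.Nullary using (¬_)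

module _ {a ℓ : Level} {A : Set a} {R : Rel A ℓ} where

  Linked-++⁻ʳ : ∀ xs {ys : List A} → Linked R (xs ++ ys) → Linked R ys
  Linked-++⁻ʳ []       l = l
  Linked-++⁻ʳ (x ∷ xs) l = Linked-++⁻ʳ xs (Linked.tail l)

  Linked-snoc : ∀ xs {x y z : A} → Linked R (xs ++ x ∷ y ∷ []) → R y z →
                Linked R (xs ++ x ∷ y ∷ z ∷ [])
  Linked-snoc []            (Rxy ∷ [-]) Ryz = Rxy ∷ Ryz ∷ [-]
  Linked-snoc (w ∷ [])      (Rwx ∷ l)   Ryz = Rwx ∷ Linked-snoc [] l Ryz
  Linked-snoc (w ∷ w′ ∷ xs) (Rww′ ∷ l)  Ryz = Rww′ ∷ Linked-snoc (w′ ∷ xs) l Ryz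

length-++-snoc : ∀ {a} {A : Set a} (zs : List A) {x y z : A} →
                 length (zs ++ x ∷ y ∷ z ∷ []) ≡ suc (length (zs ++ x ∷ y ∷ []))
length-++-snoc zs =
  trans (length-++ zs) (trans (+-suc (length zs) 2) (cong suc (sym (length-++ zs))))

module _ {N : ℕ} (lab : Labeling N) where

  ConsecLabel-snoc : ∀ {b} zs {x y z : Fin N} →
                     ConsecLabel lab b (zs ++ x ∷ y ∷ []) → lab x y z ≡ b →
                     ConsecLabel lab b (zs ++ x ∷ y ∷ z ∷ [])
  ConsecLabel-snoc []                 tt            e = e , tt
  ConsecLabel-snoc (w ∷ [])           (l , tt)      e = l , e , tt
  ConsecLabel-snoc (w ∷ w′ ∷ [])      (l , l′ , tt) e = l , l′ , e , tt
  ConsecLabel-snoc (w ∷ w′ ∷ w″ ∷ zs) (l , rest)    e = l , ConsecLabel-snoc (w′ ∷ w″ ∷ zs) rest e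

  IsCup-extendʳ : ∀ {m} zs {x y z : Fin N} → IsCup lab m (zs ++ x ∷ y ∷ []) →
                  y F.< z → lab x y z ≡ true → IsCup lab (suc m) (zs ++ x ∷ y ∷ z ∷ [])
  IsCup-extendʳ zs (len , lnk , cl) y<z xyz =
    trans (length-++-snoc zs) (cong suc len) ,
    Linked-snoc zs lnk y<z ,
    ConsecLabel-snoc zs cl xyz

  IsCup-extendˡ : ∀ {m} {x y z : Fin N} {zs} → IsCup lab m (y ∷ z ∷ zs) →
                  x F.< y → lab x y z ≡ true → IsCup lab (suc m) (x ∷ y ∷ z ∷ zs)
  IsCup-extendˡ (len , lnk , cl) x<y xyz = cong suc len , x<y ∷ lnk , xyz , cl

  cupEnd≮cupStart : ∀ {m} {p x q y : Fin N} {xs zs} → CapFree lab 4 → CupFree lab (suc m) →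
                    IsCup lab m (p ∷ x ∷ xs) → IsCup lab m (zs ++ y ∷ q ∷ []) → ¬ q F.< p
  cupEnd≮cupStart {p = p} {x} {q} {y} {zs = zs} capFree cupFree
                  cupFromP@(_ , p<x ∷ _ , _) cupToQ@(_ , linkedToQ , _) q<p
    with lab y q p in yqp | lab q p x in qpx
  ... | true  | _     = cupFree _ (IsCup-extendʳ zs cupToQ q<p yqp)
  ... | false | true  = cupFree _ (IsCup-extendˡ cupFromP q<p qpx)
  ... | false | false = capFree (y ∷ q ∷ p ∷ x ∷ [])
    (refl , Linked.head (Linked-++⁻ʳ zs linkedToQ) ∷ q<p ∷ p<x ∷ [-] , yqp , qpx , tt)

lemma5p6 : (n : ℕ) → 3 ≤ n → (N : ℕ) → (lab : Labeling N) →
    CapFree lab 4 → CupFree lab n → ((n ∸ 1) C 2) + 1 ≤ N →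
    (p q : Fin N) (xs ys : List (Fin N)) →
    IsCup lab (n ∸ 1) (p ∷ xs) → IsCup lab (n ∸ 1) (ys ∷ʳ q) →
    p F.≤ q
lemma5p6 (suc m) (s≤s (s≤s (s≤s _))) N lab capFree cupFree _ p q [] ys (() , _) cupToQ
lemma5p6 (suc m) (s≤s (s≤s (s≤s _))) N lab capFree cupFree _ p q (x ∷ xs) ys cupFromP cupToQ
  with initLast ys
... | [] with () ← proj₁ cupToQ
... | zs ∷ʳ′ y =
  ≮⇒≥ (cupEnd≮cupStart lab capFree cupFree cupFromP (subst (IsCup lab m) (++-assoc zs _ _) cupToQ))
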